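{- For every $r \ge 3$ and $2 \le \ell < k$, $\mathcal{M}_{\ell+1,k+1}^r \to \mathcal{M}_{\ell,k}^r$.
   Context: $\mathbf{LO}_k^r$ is the $r$-ary structure with domain $[k]=\{1,\dots,k\}$ and relation consisting of all tuples in $[k]^r$ with a unique maximum. For $r$-ary structures $\mathbf{A}=(A,R^{\mathbf A})$, $\mathbf{B}=(B,R^{\mathbf B})$, a $p$-ary polymorphism is a function $f: A^p\to B$ such that whenever an $r\times p$ matrix has every column in $R^{\mathbf A}$, applying $f$ to each row yields a tuple in $R^{\mathbf B}$. $\mathrm{Pol}(\mathbf A,\mathbf B)$ is the minion whose $p$-ary part is the set of $p$-ary polymorphisms, with minors: for $\pi:[p]\to[q]$, $f_\pi(x_1,\dots,x_q)=f(x_{\pi(1)},\dots,x_{\pi(p)})$. $\mathcal{M}_{\ell,k}^r = \mathrm{Pol}(\mathbf{LO}_\ell^r,\mathbf{LO}_k^r)$. A minion homomorphism $\xi:\mathcal M\to\mathcal N$ maps $p$-ary elements to $p$-ary elements with $\xi(f)_\pi=\xi(f_\pi)$ for all $\pi$ and $f$; $\mathcal M\to\mathcal N$ means one exists. -}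

module Defs where

open import Data.Nat using (ℕ; _<_)
open import Data.Fin using (Fin; toℕ)
open import Data.Product using (Σ; ∃; _×_; proj₁; proj₂; _,_)
open import Relation.Binary.PropositionalEquality using (_≡_)
open import Relation.Nullary using (¬_)
open import Level using (0ℓ) renaming (suc to lsuc)

-- Elements of [k] = {1,…,k} are represented by Fin k (shifted by one;
-- the order is the same). A tuple in [k]^r is a map Fin r → Fin k.

UniqueMax : ∀ {r k} → (Fin r → Fin k) → Set
UniqueMax {r} t = ∃ λ i → ∀ (j : Fin r) → ¬ (j ≡ i) → toℕ (t j) < toℕ (t i)

LO : (r k : ℕ) → (Fin r → Fin k) → Set
LO r k t = UniqueMax t

IsPol : (r ℓ k p : ℕ) → ((Fin p → Fin ℓ) → Fin k) → Set
IsPol r ℓ k p f =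
  (M : Fin r → Fin p → Fin ℓ) →
  (∀ (c : Fin p) → LO r ℓ (λ i → M i c)) →
  LO r k (λ i → f (M i))

record Minion : Set₁ where
  field
    El    : ℕ → Set
    _≈_   : ∀ {p} → El p → El p → Set
    minor : ∀ {p q} → (Fin p → Fin q) → El p → El q

record MinionHom (M N : Minion) : Set where
  open Minion
  field
    map      : ∀ {p} → El M p → El N p
    commutes : ∀ {p q} (π : Fin p → Fin q) (f : El M p) →
               _≈_ N (minor N π (map f)) (map (minor M π f))

_⟶_ : Minion → Minion → Set
M ⟶ N = MinionHom M N

𝓜 : (r ℓ k : ℕ) → Minion
𝓜 r ℓ k = record
  { El    = λ p → Σ ((Fin p → Fin ℓ) → Fin k) (IsPol r ℓ k p)
  ; _≈_   = λ f g → ∀ x → proj₁ f x ≡ proj₁ g x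
  ; minor = λ {p} {q} π f →
      (λ x → proj₁ f (λ i → x (π i))) ,
      (λ M cols → proj₂ f (λ i c → M i (π c)) (λ c → cols (π c)))
  }

{-# OPTIONS --safe #-}
module Submission where

-- Restrict a polymorphism LO_{ℓ+1} → LO_{k+1} to inputs avoiding the least
-- element 1 and shift everything down by one. Its values then avoid 1 as well:
-- place x+1 in the first row of a matrix and 1 in all other rows; the columns
-- have a unique maximum, and since r ≥ 3 the output rows repeat the value
-- f(1,…,1) at least twice, so the unique maximum is f(x+1) > f(1,…,1) ≥ 1.
-- Shifting by one is order preserving, so unique maxima survive, and it
-- commutes with taking minors.

open import Defs
open import Data.Nat using (ℕ; suc; _≤_; _<_; _+_; z≤n; s≤s; s≤s⁻¹)
open import Data.Nat.Properties using (<-irrefl; ≤-trans)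
open import Data.Fin using (Fin; toℕ; zero; suc; reduce≥)
open import Data.Product using (_,_)
open import Data.Empty using (⊥-elim)
open import Function using (_∘_)
open import Relation.Binary.PropositionalEquality using (_≡_; sym; cong; refl)

UniqueMax-suc : ∀ {r k} {t : Fin r → Fin k} → UniqueMax t → UniqueMax (suc ∘ t)
UniqueMax-suc (i , above) = i , λ j j≢i → s≤s (above j j≢i)

reduce≥₁-mono-< : ∀ {k} (y z : Fin (suc k)) .(1≤y : 1 ≤ toℕ y) .(1≤z : 1 ≤ toℕ z) →
  toℕ y < toℕ z → toℕ (reduce≥ {m = 1} y 1≤y) < toℕ (reduce≥ {m = 1} z 1≤z)
reduce≥₁-mono-< (suc y) (suc z) _ _ y<z = s≤s⁻¹ y<z

UniqueMax-reduce≥₁ : ∀ {r k} (t : Fin r → Fin (suc k)) .(1≤t : ∀ i → 1 ≤ toℕ (t i)) →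
  UniqueMax t → UniqueMax (λ i → reduce≥ {m = 1} (t i) (1≤t i))
UniqueMax-reduce≥₁ t 1≤t (i , above) =
  i , λ j j≢i → reduce≥₁-mono-< (t j) (t i) (1≤t j) (1≤t i) (above j j≢i)

UniqueMax-constantTail⇒head>tail : ∀ {r k} (t : Fin (3 + r) → Fin k) →
  (∀ j → t (suc j) ≡ t (suc zero)) → UniqueMax t → toℕ (t (suc zero)) < toℕ (t zero)
UniqueMax-constantTail⇒head>tail t tail (zero , above) = above (suc zero) λ ()
UniqueMax-constantTail⇒head>tail t tail (suc zero , above) =
  ⊥-elim (<-irrefl (cong toℕ (tail (suc zero))) (above (suc (suc zero)) λ ()))
UniqueMax-constantTail⇒head>tail t tail (suc (suc m) , above) =
  ⊥-elim (<-irrefl (cong toℕ (sym (tail (suc m)))) (above (suc zero) λ ()))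

module DropBottom {r ℓ k p : ℕ} (f : (Fin p → Fin (suc ℓ)) → Fin (suc k))
                  (f-pol : IsPol (3 + r) (suc ℓ) (suc k) p f) where

  isolatingMatrix : (Fin p → Fin ℓ) → Fin (3 + r) → Fin p → Fin (suc ℓ)
  isolatingMatrix x zero    = suc ∘ x
  isolatingMatrix x (suc _) = λ _ → zero

  isolatingMatrix-columns : ∀ x c → LO (3 + r) (suc ℓ) (λ i → isolatingMatrix x i c)
  isolatingMatrix-columns x c = zero , λ { zero 0≢0 → ⊥-elim (0≢0 refl)
                                         ; (suc j) _ → s≤s z≤n }

  f-positive : ∀ x → 1 ≤ toℕ (f (suc ∘ x))
  f-positive x = ≤-trans (s≤s z≤n)
    (UniqueMax-constantTail⇒head>tail (λ i → f (isolatingMatrix x i)) (λ _ → refl)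
      (f-pol (isolatingMatrix x) (isolatingMatrix-columns x)))

  restriction : (Fin p → Fin ℓ) → Fin k
  restriction x = reduce≥ {m = 1} (f (suc ∘ x)) (f-positive x)

  restriction-pol : IsPol (3 + r) ℓ k p restriction
  restriction-pol M columns =
    UniqueMax-reduce≥₁ (λ i → f (suc ∘ M i)) (f-positive ∘ M)
      (f-pol (λ i → suc ∘ M i) (λ c → UniqueMax-suc (columns c)))

𝓜-dropBottom : ∀ r ℓ k → 𝓜 (3 + r) (suc ℓ) (suc k) ⟶ 𝓜 (3 + r) ℓ k
𝓜-dropBottom r ℓ k = record
  { map      = λ (f , f-pol) → DropBottom.restriction f f-pol , DropBottom.restriction-pol f f-pol
  ; commutes = λ _ _ _ → refl
  }

theorem5p8 : ∀ (r ℓ k : ℕ) → 3 ≤ r → 2 ≤ ℓ → ℓ < k →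
    𝓜 r (suc ℓ) (suc k) ⟶ 𝓜 r ℓ k
theorem5p8 (suc (suc (suc r))) ℓ k (s≤s (s≤s (s≤s _))) _ _ = 𝓜-dropBottom r ℓ k
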